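{- Let $\mathcal S$ be a semioval in a projective plane of order $q$ with $|\mathcal S|=q+1+\epsilon$. Then $\mathcal S$ has at most $|\mathcal S|(1+\epsilon/3)$ odd-secants.
   Context: A tangent to a point set is a line meeting it in exactly one point. A semioval is a point set $\mathcal S$ such that through each point of $\mathcal S$ there passes exactly one tangent to $\mathcal S$. An odd-secant of $\mathcal S$ is a line meeting $\mathcal S$ in an odd number of points. -}

module Defs where

open import Data.Nat using (ℕ; zero; suc; _+_; _%_; _≡ᵇ_)
open import Data.Fin using (Fin)
open import Data.Bool using (Bool; true; false; _∧_; if_then_else_)
open import Data.Product using (Σ; _×_; ∃; ∃-syntax)
open import Relation.Binary.PropositionalEquality using (_≡_; _≢_)
open import Relation.Nullary using (¬_)

count : ∀ {n} → (Fin n → Bool) → ℕ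
count {zero}  P = 0
count {suc n} P = (if P Fin.zero then 1 else 0) + count {n} (λ i → P (Fin.suc i))

record ProjectivePlane (q : ℕ) : Set where
  field
    nPoints nLines : ℕ
    _I_ : Fin nPoints → Fin nLines → Bool
  Collinear : Fin nPoints → Fin nPoints → Fin nPoints → Set
  Collinear a b c = ∃[ l ] ((a I l ≡ true) × (b I l ≡ true) × (c I l ≡ true))
  field
    line-exists : ∀ p p' → p ≢ p' → ∃[ l ] ((p I l ≡ true) × (p' I l ≡ true))
    line-unique : ∀ p p' l l' → p ≢ p' →
                  p I l ≡ true → p' I l ≡ true → p I l' ≡ true → p' I l' ≡ true → l ≡ l'
    point-exists : ∀ l l' → l ≢ l' → ∃[ p ] ((p I l ≡ true) × (p I l' ≡ true))
    point-unique : ∀ l l' p p' → l ≢ l' →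
                   p I l ≡ true → p I l' ≡ true → p' I l ≡ true → p' I l' ≡ true → p ≡ p'
    nondegenerate : ∃[ a ] ∃[ b ] ∃[ c ] ∃[ d ]
                      (¬ Collinear a b c × ¬ Collinear a b d × ¬ Collinear a c d × ¬ Collinear b c d)
    order : ∀ l → count (λ p → p I l) ≡ suc q

module _ {q : ℕ} (Π : ProjectivePlane q) where
  open ProjectivePlane Π

  PointSet : Set
  PointSet = Fin nPoints → Bool

  size : PointSet → ℕ
  size S = count S

  meet : PointSet → Fin nLines → ℕ
  meet S l = count (λ p → S p ∧ (p I l))

  isTangent : PointSet → Fin nLines → Bool
  isTangent S l = meet S l ≡ᵇ 1

  IsSemioval : PointSet → Set
  IsSemioval S = ∀ p → S p ≡ true → count (λ l → (p I l) ∧ isTangent S l) ≡ 1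

  isOddSecant : PointSet → Fin nLines → Bool
  isOddSecant S l = (meet S l % 2) ≡ᵇ 1

  numOddSecants : PointSet → ℕ
  numOddSecants S = count (isOddSecant S)

-- Spread each odd-secant over its points: a tangent gives its point weight 3,
-- an odd k-secant with k ≥ 3 gives each of its points weight 1 ≥ 3/k, so
-- 3 · #odd-secants ≤ ∑_{P ∈ S} w(P), where w(P) is the weight collected at P.
-- A point P ∈ S lies on exactly one tangent and on at least q + 1 lines, every
-- one of which except the tangent meets S again, while together these lines
-- meet S ∖ {P} only |S| − 1 = q + ε times.  Hence at most ε of them meet S in
-- three or more points, and w(P) ≤ 3 + ε.
module Submission where

open import Defs
open import Data.Bool using (Bool; true; false; _∧_; if_then_else_)
open import Data.Bool.Properties using (∧-idem)
open import Data.Empty using (⊥-elim)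
open import Data.Fin as Fin using (Fin; zero; suc; punchIn)
open import Data.Fin.Properties using (punchInᵢ≢i; suc-injective; 0≢1+n)
open import Data.List using ([]; _∷_)
open import Data.Nat using (ℕ; zero; suc; _+_; _*_; _≤_; z≤n; s≤s; _%_; _≡ᵇ_)
open import Data.Nat.Properties hiding (_≟_; 0≢1+n; suc-injective)
open import Data.Nat.Tactic.RingSolver using (solve; solve-∀)
open import Algebra.Properties.CommutativeSemigroup *-commutativeSemigroup using (x∙yz≈y∙xz)
open import Algebra.Properties.Semiring.Sum +-*-semiring
  using (sum; sum-cong-≗; sum-remove; ∑-comm; ∑-distrib-+; *-distribˡ-sum; *-distribʳ-sum)
open import Data.Product using (∃; _×_; _,_; proj₁; proj₂)
open import Function using (_∘_)
open import Relation.Binary.PropositionalEquality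
open import Relation.Nullary using (¬_; yes; no)

𝟙 : Bool → ℕ
𝟙 b = if b then 1 else 0

𝟙-∧ : ∀ a b → 𝟙 (a ∧ b) ≡ 𝟙 a * 𝟙 b
𝟙-∧ true  b = sym (+-identityʳ (𝟙 b))
𝟙-∧ false b = refl

∧≡true⇒ : ∀ {a b} → a ∧ b ≡ true → a ≡ true × b ≡ true
∧≡true⇒ {true} b≡true = refl , b≡true

∑ᵇ : ∀ {n} → (Fin n → Bool) → (Fin n → ℕ) → ℕ
∑ᵇ A f = sum (λ i → 𝟙 (A i) * f i)

sum-mono-≤ : ∀ {n} {f g : Fin n → ℕ} → (∀ i → f i ≤ g i) → sum f ≤ sum g
sum-mono-≤ {zero}  _   = z≤n
sum-mono-≤ {suc n} f≤g = +-mono-≤ (f≤g zero) (sum-mono-≤ (f≤g ∘ suc))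

count≡sum : ∀ {n} (A : Fin n → Bool) → count A ≡ sum (𝟙 ∘ A)
count≡sum {zero}  A = refl
count≡sum {suc n} A = cong (𝟙 (A zero) +_) (count≡sum (A ∘ suc))

count-cong : ∀ {n} {A B : Fin n → Bool} → (∀ i → A i ≡ B i) → count A ≡ count B
count-cong {A = A} {B} A≗B = begin
  count A       ≡⟨ count≡sum A ⟩
  sum (𝟙 ∘ A)   ≡⟨ sum-cong-≗ (cong 𝟙 ∘ A≗B) ⟩
  sum (𝟙 ∘ B)   ≡⟨ count≡sum B ⟨
  count B       ∎
  where open ≡-Reasoning

count-∧ : ∀ {n} (A B : Fin n → Bool) → count (λ i → A i ∧ B i) ≡ ∑ᵇ A (𝟙 ∘ B)
count-∧ A B = trans (count≡sum (λ i → A i ∧ B i)) (sum-cong-≗ (λ i → 𝟙-∧ (A i) (B i)))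

count-≥1 : ∀ {n} (A : Fin n → Bool) {i} → A i ≡ true → 1 ≤ count A
count-≥1 A {zero}  A0≡true rewrite A0≡true = s≤s z≤n
count-≥1 A {suc i} Ai≡true = ≤-trans (count-≥1 (A ∘ suc) Ai≡true) (m≤n+m _ _)

count-witness : ∀ {n} (A : Fin n → Bool) → 1 ≤ count A → ∃ λ i → A i ≡ true
count-witness {suc n} A 1≤count with A zero in A0
... | true  = zero , A0
... | false = let i , Ai = count-witness (A ∘ suc) 1≤count in suc i , Ai

count-none : ∀ {n} (A : Fin n → Bool) → (∀ i → A i ≢ true) → count A ≡ 0
count-none {zero}  A none = refl
count-none {suc n} A none with A zero in A0
... | true  = ⊥-elim (none zero A0)
... | false = count-none (A ∘ suc) (none ∘ suc)

count-≤1 : ∀ {n} (A : Fin n → Bool) → (∀ i j → A i ≡ true → A j ≡ true → i ≡ j) → count A ≤ 1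
count-≤1 {zero}  A unique = z≤n
count-≤1 {suc n} A unique with A zero in A0
... | true  = ≤-reflexive (cong suc (count-none (A ∘ suc) (λ i Ai → 0≢1+n (unique _ _ A0 Ai))))
... | false = count-≤1 (A ∘ suc) (λ i j Ai Aj → suc-injective (unique _ _ Ai Aj))

∑ᵇ-mono-≤ : ∀ {n} (A : Fin n → Bool) {f g : Fin n → ℕ} →
            (∀ i → A i ≡ true → f i ≤ g i) → ∑ᵇ A f ≤ ∑ᵇ A g
∑ᵇ-mono-≤ A f≤g = sum-mono-≤ pointwise
  where
  pointwise : ∀ i → 𝟙 (A i) * _ ≤ 𝟙 (A i) * _
  pointwise i with A i in Ai
  ... | true  = +-monoˡ-≤ 0 (f≤g i Ai)
  ... | false = z≤n

∑ᵇ-const : ∀ {n} (A : Fin n → Bool) c → ∑ᵇ A (λ _ → c) ≡ count A * c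
∑ᵇ-const A c = trans (sym (*-distribʳ-sum c (𝟙 ∘ A))) (cong (_* c) (sym (count≡sum A)))

∑ᵇ-+ : ∀ {n} (A : Fin n → Bool) (f g : Fin n → ℕ) →
       ∑ᵇ A (λ i → f i + g i) ≡ ∑ᵇ A f + ∑ᵇ A g
∑ᵇ-+ A f g = trans (sum-cong-≗ (λ i → *-distribˡ-+ (𝟙 (A i)) (f i) (g i)))
                   (∑-distrib-+ (λ i → 𝟙 (A i) * f i) (λ i → 𝟙 (A i) * g i))

∑ᵇ-*ˡ : ∀ {n} (A : Fin n → Bool) c (f : Fin n → ℕ) → ∑ᵇ A (λ i → c * f i) ≡ c * ∑ᵇ A f
∑ᵇ-*ˡ A c f = trans (sum-cong-≗ (λ i → x∙yz≈y∙xz (𝟙 (A i)) c (f i)))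
                    (sym (*-distribˡ-sum c (λ i → 𝟙 (A i) * f i)))

∑ᵇ+1≤count+ : ∀ {n} (A : Fin n → Bool) (f : Fin n → ℕ) {i} → A i ≡ true →
              (∀ j → j ≢ i → f j ≤ 1) → ∑ᵇ A f + 1 ≤ count A + f i
∑ᵇ+1≤count+ {suc n} A f {i} Ai f≤1 = begin
  ∑ᵇ A f + 1                           ≡⟨ cong (_+ 1) (sum-remove {i = i} (λ j → 𝟙 (A j) * f j)) ⟩
  𝟙 (A i) * f i + ∑ᵇ A′ f′ + 1        ≡⟨ cong (λ a → 𝟙 a * f i + ∑ᵇ A′ f′ + 1) Ai ⟩
  f i + 0 + ∑ᵇ A′ f′ + 1               ≤⟨ +-monoˡ-≤ 1 (+-monoʳ-≤ (f i + 0) (sum-mono-≤ off-i)) ⟩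
  f i + 0 + sum (𝟙 ∘ A′) + 1           ≡⟨ rearrange (f i) (sum (𝟙 ∘ A′)) ⟩
  1 + sum (𝟙 ∘ A′) + f i               ≡⟨ cong (λ a → 𝟙 a + sum (𝟙 ∘ A′) + f i) Ai ⟨
  𝟙 (A i) + sum (𝟙 ∘ A′) + f i         ≡⟨ cong (_+ f i) (sum-remove {i = i} (𝟙 ∘ A)) ⟨
  sum (𝟙 ∘ A) + f i                    ≡⟨ cong (_+ f i) (count≡sum A) ⟨
  count A + f i                        ∎
  where
  open ≤-Reasoning
  A′ = A ∘ punchIn i
  f′ = f ∘ punchIn i
  off-i : ∀ j → 𝟙 (A′ j) * f′ j ≤ 𝟙 (A′ j)
  off-i j with A′ j
  ... | true  = +-monoˡ-≤ 0 (f≤1 (punchIn i j) (punchInᵢ≢i i j))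
  ... | false = z≤n
  rearrange : ∀ x r → x + 0 + r + 1 ≡ 1 + r + x
  rearrange = solve-∀

double-counting : ∀ {m n} (A : Fin m → Bool) (R : Fin m → Fin n → Bool) (g : Fin n → ℕ) →
                  sum (λ j → count (λ i → A i ∧ R i j) * g j) ≡ ∑ᵇ A (λ i → ∑ᵇ (R i) g)
double-counting A R g = begin
  sum (λ j → count (λ i → A i ∧ R i j) * g j)                ≡⟨ sum-cong-≗ (λ j → cong (_* g j) (count-∧ A (λ i → R i j))) ⟩
  sum (λ j → sum (λ i → 𝟙 (A i) * 𝟙 (R i j)) * g j)          ≡⟨ sum-cong-≗ (λ j → *-distribʳ-sum (g j) (λ i → 𝟙 (A i) * 𝟙 (R i j))) ⟩
  sum (λ j → sum (λ i → 𝟙 (A i) * 𝟙 (R i j) * g j))          ≡⟨ ∑-comm (λ i j → 𝟙 (A i) * 𝟙 (R i j) * g j) ⟨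
  sum (λ i → sum (λ j → 𝟙 (A i) * 𝟙 (R i j) * g j))          ≡⟨ sum-cong-≗ (λ i → sum-cong-≗ (λ j → *-assoc (𝟙 (A i)) (𝟙 (R i j)) (g j))) ⟩
  sum (λ i → sum (λ j → 𝟙 (A i) * (𝟙 (R i j) * g j)))        ≡⟨ sum-cong-≗ (λ i → *-distribˡ-sum (𝟙 (A i)) (λ j → 𝟙 (R i j) * g j)) ⟨
  ∑ᵇ A (λ i → ∑ᵇ (R i) g)                                    ∎
  where open ≡-Reasoning

isOdd : ℕ → Bool
isOdd m = m % 2 ≡ᵇ 1

-- An odd k-secant hands each of its k points 3/k, rounded up: 3 for a tangent, 1 when k ≥ 3.
weight : ℕ → ℕ
weight 0             = 0
weight 1             = 3
weight (suc (suc k)) = 𝟙 (isOdd k)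

3*isOdd≤*weight : ∀ k → 3 * 𝟙 (isOdd k) ≤ k * weight k
3*isOdd≤*weight 0                   = z≤n
3*isOdd≤*weight 1                   = ≤-refl
3*isOdd≤*weight 2                   = z≤n
3*isOdd≤*weight (suc (suc (suc k))) with isOdd (suc k)
... | true  = ≤-trans (m≤m+n 3 k) (≤-reflexive (sym (*-identityʳ (3 + k))))
... | false = z≤n

weight+2≤ : ∀ k → 1 ≤ k → weight k + 2 ≤ k + 4 * 𝟙 (k ≡ᵇ 1)
weight+2≤ 1                   _ = ≤-refl
weight+2≤ 2                   _ = ≤-refl
weight+2≤ (suc (suc (suc k))) _ =
  ≤-trans (+-monoˡ-≤ 2 (𝟙≤1 (isOdd (suc k)))) (≤-trans (s≤s (s≤s (s≤s z≤n))) (m≤m+n (3 + k) _))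
  where
  𝟙≤1 : ∀ b → 𝟙 b ≤ 1
  𝟙≤1 true  = ≤-refl
  𝟙≤1 false = z≤n

weight-arithmetic : ∀ {q ε W L K} → W + L * 2 ≤ K + 4 → K + 1 ≤ q + 1 + ε + L → suc q ≤ L →
                    W ≤ 3 + ε
weight-arithmetic {q} {ε} {W} {L} {K} W+2L≤K+4 K+1≤|S|+L q<L = +-cancelˡ-≤ (L + L + 1) W (3 + ε) (begin
  L + L + 1 + W           ≡⟨ solve (L ∷ W ∷ []) ⟩
  W + L * 2 + 1           ≤⟨ +-monoˡ-≤ 1 W+2L≤K+4 ⟩
  K + 4 + 1               ≡⟨ solve (K ∷ []) ⟩
  K + 1 + 4               ≤⟨ +-monoˡ-≤ 4 K+1≤|S|+L ⟩
  q + 1 + ε + L + 4       ≡⟨ solve (q ∷ ε ∷ L ∷ []) ⟩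
  suc q + (L + 4 + ε)     ≤⟨ +-monoˡ-≤ (L + 4 + ε) q<L ⟩
  L + (L + 4 + ε)         ≡⟨ solve (L ∷ ε ∷ []) ⟩
  L + L + 1 + (3 + ε)     ∎)
  where open ≤-Reasoning

module Plane {q : ℕ} (Π : ProjectivePlane q) where
  open ProjectivePlane Π

  Point = Fin nPoints
  Line  = Fin nLines

  linesThrough : Point → ℕ
  linesThrough P = count (P I_)

  commonLines : Point → Point → ℕ
  commonLines P Q = count (λ l → P I l ∧ Q I l)

  commonLines-self : ∀ P → commonLines P P ≡ linesThrough P
  commonLines-self P = count-cong (λ l → ∧-idem (P I l))

  commonLines-≤1 : ∀ {P Q} → P ≢ Q → commonLines P Q ≤ 1
  commonLines-≤1 {P} {Q} P≢Q = count-≤1 (λ l → P I l ∧ Q I l) λ l l′ P,Q∈l P,Q∈l′ →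
    let P∈l , Q∈l = ∧≡true⇒ P,Q∈l ; P∈l′ , Q∈l′ = ∧≡true⇒ P,Q∈l′
    in line-unique P Q l l′ P≢Q P∈l Q∈l P∈l′ Q∈l′

  commonLines-≥1 : ∀ {P Q} → P ≢ Q → 1 ≤ commonLines P Q
  commonLines-≥1 {P} {Q} P≢Q =
    let l , P∈l , Q∈l = line-exists P Q P≢Q in count-≥1 (λ l → P I l ∧ Q I l) (cong₂ _∧_ P∈l Q∈l)

  ∑ᵇ-meet≡∑ᵇ-commonLines : ∀ (A : PointSet Π) P →
                           ∑ᵇ (P I_) (meet Π A) ≡ ∑ᵇ A (λ Q → commonLines Q P)
  ∑ᵇ-meet≡∑ᵇ-commonLines A P = begin
    ∑ᵇ (P I_) (meet Π A)                          ≡⟨ sum-cong-≗ (λ l → *-comm (𝟙 (P I l)) (meet Π A l)) ⟩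
    sum (λ l → meet Π A l * 𝟙 (P I l))            ≡⟨ double-counting A _I_ (𝟙 ∘ (P I_)) ⟩
    ∑ᵇ A (λ Q → ∑ᵇ (Q I_) (𝟙 ∘ (P I_)))           ≡⟨ sum-cong-≗ (λ Q → cong (𝟙 (A Q) *_) (count-∧ (Q I_) (P I_))) ⟨
    ∑ᵇ A (λ Q → commonLines Q P)                  ∎
    where open ≡-Reasoning

  -- P is joined to each of the q + 1 points of m by a different line.
  linesThrough-≥ : ∀ {P m} → P I m ≡ false → suc q ≤ linesThrough P
  linesThrough-≥ {P} {m} P∉m = begin
    suc q                                   ≡⟨ order m ⟨
    count (_I m)                            ≡⟨ *-identityʳ _ ⟨
    count (_I m) * 1                        ≡⟨ ∑ᵇ-const (_I m) 1 ⟨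
    ∑ᵇ (_I m) (λ _ → 1)                     ≤⟨ ∑ᵇ-mono-≤ (_I m) (λ Q Q∈m → commonLines-≥1 (Q≢P Q∈m)) ⟩
    ∑ᵇ (_I m) (λ Q → commonLines Q P)       ≡⟨ ∑ᵇ-meet≡∑ᵇ-commonLines (_I m) P ⟨
    ∑ᵇ (P I_) (meet Π (_I m))               ≤⟨ ∑ᵇ-mono-≤ (P I_) (λ l P∈l → count-≤1 _ (m∩l-unique (m≢l P∈l))) ⟩
    ∑ᵇ (P I_) (λ _ → 1)                     ≡⟨ ∑ᵇ-const (P I_) 1 ⟩
    linesThrough P * 1                      ≡⟨ *-identityʳ _ ⟩
    linesThrough P                          ∎
    where
    open ≤-Reasoning
    Q≢P : ∀ {Q} → Q I m ≡ true → Q ≢ P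
    Q≢P Q∈m refl with () ← trans (sym P∉m) Q∈m
    m≢l : ∀ {l} → P I l ≡ true → m ≢ l
    m≢l P∈l refl with () ← trans (sym P∉m) P∈l
    m∩l-unique : ∀ {l} → m ≢ l → ∀ Q Q′ → (Q I m ∧ Q I l) ≡ true → (Q′ I m ∧ Q′ I l) ≡ true → Q ≡ Q′
    m∩l-unique {l} m≢l Q Q′ Q∈m∩l Q′∈m∩l =
      let Q∈m , Q∈l = ∧≡true⇒ Q∈m∩l ; Q′∈m , Q′∈l = ∧≡true⇒ Q′∈m∩l
      in point-unique m l Q Q′ m≢l Q∈m Q∈l Q′∈m Q′∈l

  -- The axioms alone do not put every point on a line (one point and no lines is a model).
  module _ {P : Point} {t : Line} (P∈t : P I t ≡ true) where

    private
      lineThrough : ∀ x → ∃ λ l → x I l ≡ true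
      lineThrough x with x Fin.≟ P
      ... | yes refl = t , P∈t
      ... | no  x≢P  = let l , x∈l , _ = line-exists x P x≢P in l , x∈l

      joiningLine : ∀ x y → ∃ λ l → x I l ≡ true × y I l ≡ true
      joiningLine x y with x Fin.≟ y
      ... | no  x≢y  = line-exists x y x≢y
      ... | yes refl = let l , x∈l = lineThrough x in l , x∈l , x∈l

      ¬Collinear⇒≢₁₂ : ∀ {a b c} → ¬ Collinear a b c → a ≢ b
      ¬Collinear⇒≢₁₂ {a} {c = c} ¬abc refl = let l , a∈l , c∈l = joiningLine a c in ¬abc (l , a∈l , a∈l , c∈l)

      ¬Collinear⇒≢₁₃ : ∀ {a b c} → ¬ Collinear a b c → a ≢ c
      ¬Collinear⇒≢₁₃ {a} {b} ¬abc refl = let l , a∈l , b∈l = joiningLine a b in ¬abc (l , a∈l , b∈l , a∈l)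

      ¬Collinear⇒≢₂₃ : ∀ {a b c} → ¬ Collinear a b c → b ≢ c
      ¬Collinear⇒≢₂₃ {a} {b} ¬abc refl = let l , a∈l , b∈l = joiningLine a b in ¬abc (l , a∈l , b∈l , b∈l)

    -- If P lay on ab, ac and cd, then P = ab ∩ ac = a would put a on cd.
    line-missing : ∃ λ m → P I m ≡ false
    line-missing with nondegenerate
    ... | a , b , c , d , ¬abc , _ , ¬acd , _
        with line-exists a b (¬Collinear⇒≢₁₂ ¬abc) | line-exists a c (¬Collinear⇒≢₁₃ ¬abc)
           | line-exists c d (¬Collinear⇒≢₂₃ ¬acd)
    ... | ab , a∈ab , b∈ab | ac , a∈ac , c∈ac | cd , c∈cd , d∈cd
        with P I ab in P∈ab | P I ac in P∈ac | P I cd in P∈cd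
    ... | false | _     | _     = ab , P∈ab
    ... | true  | false | _     = ac , P∈ac
    ... | true  | true  | false = cd , P∈cd
    ... | true  | true  | true  with P Fin.≟ a
    ...   | yes refl = ⊥-elim (¬acd (cd , P∈cd , c∈cd , d∈cd))
    ...   | no  P≢a  = ⊥-elim (¬abc (ab , a∈ab , b∈ab , subst (λ l → c I l ≡ true) (sym ab≡ac) c∈ac))
      where
      ab≡ac : ab ≡ ac
      ab≡ac = line-unique P a ab ac P≢a P∈ab a∈ab P∈ac a∈ac

  ∑ᵇ-meet+1≤size+lines : ∀ (A : PointSet Π) {P} → A P ≡ true →
                 ∑ᵇ (P I_) (meet Π A) + 1 ≤ size Π A + linesThrough P
  ∑ᵇ-meet+1≤size+lines A {P} P∈A = begin
    ∑ᵇ (P I_) (meet Π A) + 1                 ≡⟨ cong (_+ 1) (∑ᵇ-meet≡∑ᵇ-commonLines A P) ⟩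
    ∑ᵇ A (λ Q → commonLines Q P) + 1         ≤⟨ ∑ᵇ+1≤count+ A (λ Q → commonLines Q P) P∈A (λ Q Q≢P → commonLines-≤1 Q≢P) ⟩
    size Π A + commonLines P P               ≡⟨ cong (size Π A +_) (commonLines-self P) ⟩
    size Π A + linesThrough P                ∎
    where open ≤-Reasoning

  module Semioval {S : PointSet Π} (semioval : IsSemioval Π S) where

    tangentThrough : ∀ {P} → S P ≡ true → ∃ λ t → P I t ≡ true
    tangentThrough {P} P∈S =
      let t , P∈t∧tangent = count-witness _ (≤-reflexive (sym (semioval P P∈S)))
      in t , proj₁ (∧≡true⇒ P∈t∧tangent)

    ∑ᵇ-weight+2*lines≤∑ᵇ-meet+4 : ∀ {P} → S P ≡ true →
      ∑ᵇ (P I_) (weight ∘ meet Π S) + linesThrough P * 2 ≤ ∑ᵇ (P I_) (meet Π S) + 4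
    ∑ᵇ-weight+2*lines≤∑ᵇ-meet+4 {P} P∈S = begin
      ∑ᵇ (P I_) w + linesThrough P * 2                   ≡⟨ cong (∑ᵇ (P I_) w +_) (∑ᵇ-const (P I_) 2) ⟨
      ∑ᵇ (P I_) w + ∑ᵇ (P I_) (λ _ → 2)                  ≡⟨ ∑ᵇ-+ (P I_) w (λ _ → 2) ⟨
      ∑ᵇ (P I_) (λ l → weight (k l) + 2)                 ≤⟨ ∑ᵇ-mono-≤ (P I_) (λ l P∈l → weight+2≤ (k l) (k≥1 P∈l)) ⟩
      ∑ᵇ (P I_) (λ l → k l + 4 * 𝟙 (isTangent Π S l))    ≡⟨ ∑ᵇ-+ (P I_) k (λ l → 4 * 𝟙 (isTangent Π S l)) ⟩
      ∑ᵇ (P I_) k + ∑ᵇ (P I_) (λ l → 4 * 𝟙 (isTangent Π S l))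
                                                         ≡⟨ cong (∑ᵇ (P I_) k +_) (∑ᵇ-*ˡ (P I_) 4 (𝟙 ∘ isTangent Π S)) ⟩
      ∑ᵇ (P I_) k + 4 * ∑ᵇ (P I_) (𝟙 ∘ isTangent Π S)    ≡⟨ cong (λ n → ∑ᵇ (P I_) k + 4 * n) (count-∧ (P I_) (isTangent Π S)) ⟨
      ∑ᵇ (P I_) k + 4 * count (λ l → P I l ∧ isTangent Π S l)
                                                         ≡⟨ cong (λ n → ∑ᵇ (P I_) k + 4 * n) (semioval P P∈S) ⟩
      ∑ᵇ (P I_) k + 4                                    ∎
      where
      open ≤-Reasoning
      k = meet Π S
      w = weight ∘ k
      k≥1 : ∀ {l} → P I l ≡ true → 1 ≤ k l
      k≥1 {l} P∈l = count-≥1 (λ Q → S Q ∧ Q I l) (cong₂ _∧_ P∈S P∈l)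

    ∑ᵇ-weight≤3+ε : ∀ {ε} → size Π S ≡ q + 1 + ε → ∀ {P} → S P ≡ true →
                       ∑ᵇ (P I_) (weight ∘ meet Π S) ≤ 3 + ε
    ∑ᵇ-weight≤3+ε |S|≡ {P} P∈S =
      let _ , P∉m = line-missing (proj₂ (tangentThrough P∈S)) in
      weight-arithmetic
        (∑ᵇ-weight+2*lines≤∑ᵇ-meet+4 P∈S)
        (subst (λ s → ∑ᵇ (P I_) (meet Π S) + 1 ≤ s + linesThrough P) |S|≡ (∑ᵇ-meet+1≤size+lines S P∈S))
        (linesThrough-≥ P∉m)

lemma5p2 : (q : ℕ) (Π : ProjectivePlane q) (S : PointSet Π) (ε : ℕ) →
           IsSemioval Π S → size Π S ≡ q + 1 + ε →
           3 * numOddSecants Π S ≤ size Π S * (3 + ε)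
lemma5p2 q Π S ε semioval |S|≡ = begin
  3 * numOddSecants Π S                              ≡⟨ cong (3 *_) (count≡sum (isOddSecant Π S)) ⟩
  3 * sum (𝟙 ∘ isOddSecant Π S)                      ≡⟨ *-distribˡ-sum 3 (𝟙 ∘ isOddSecant Π S) ⟩
  sum (λ l → 3 * 𝟙 (isOdd (k l)))                    ≤⟨ sum-mono-≤ (λ l → 3*isOdd≤*weight (k l)) ⟩
  sum (λ l → k l * weight (k l))                     ≡⟨ double-counting S _I_ (weight ∘ k) ⟩
  ∑ᵇ S (λ P → ∑ᵇ (P I_) (weight ∘ k))                ≤⟨ ∑ᵇ-mono-≤ S (λ P → ∑ᵇ-weight≤3+ε |S|≡) ⟩
  ∑ᵇ S (λ _ → 3 + ε)                                 ≡⟨ ∑ᵇ-const S (3 + ε) ⟩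
  size Π S * (3 + ε)                                 ∎
  where
  open ≤-Reasoning
  open ProjectivePlane Π
  open Plane Π
  open Semioval semioval
  k = meet Π S
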